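{- Let $n\geq 11$ be an integer. Then $\chi_{md}(P_{n+6})\geq \chi_{md}(P_n)+1$, where $P_m$ denotes the path on $m$ vertices.
   Context: For a vertex $v$, $N[v]=N(v)\cup\{v\}$; $v$ dominates exactly the vertices of $N[v]$. A majority dominator coloring of $G$ is a proper vertex coloring such that for every vertex $v$ there is a color class $C$ with $|N[v]\cap C|\geq |C|/2$. $\chi_{md}(G)$ is the minimum number of color classes in a majority dominator coloring of $G$. -}

module Defs where

open import Data.Nat using (ℕ; suc; _+_; _*_; _≤_)
open import Data.Fin using (Fin; toℕ)
open import Data.Fin.Properties using (_≟_)
open import Data.List using (length; filter)
open import Data.Product using (Σ; _×_; ∃)
open import Data.Sum using (_⊎_)
open import Relation.Binary.PropositionalEquality using (_≡_)
open import Relation.Nullary using (¬_; Dec)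
open import Relation.Nullary.Decidable using (_⊎-dec_; _×-dec_)
import Data.Nat as ℕ

open import Data.List using () renaming (allFin to vertices)

record Graph (m : ℕ) : Set₁ where
  field
    Adj  : Fin m → Fin m → Set
    adj? : (u v : Fin m) → Dec (Adj u v)

open Graph public

path : (m : ℕ) → Graph m
path m = record
  { Adj  = λ u v → (suc (toℕ u) ≡ toℕ v) ⊎ (suc (toℕ v) ≡ toℕ u)
  ; adj? = λ u v → (suc (toℕ u) ℕ.≟ toℕ v) ⊎-dec (suc (toℕ v) ℕ.≟ toℕ u)
  }

Coloring : ℕ → ℕ → Set
Coloring m k = Fin m → Fin k

Proper : ∀ {m k} → Graph m → Coloring m k → Set
Proper G c = ∀ u v → Adj G u v → ¬ (c u ≡ c v)

-- every one of the k colors is used (exactly k nonempty color classes)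
Surjective : ∀ {m k} → Coloring m k → Set
Surjective {m} {k} c = ∀ (j : Fin k) → ∃ λ v → c v ≡ j

classSize : ∀ {m k} → Coloring m k → Fin k → ℕ
classSize {m} c j = length (filter (λ v → c v ≟ j) (vertices m))

closedNbhdInClass : ∀ {m k} → Graph m → Coloring m k → Fin m → Fin k → ℕ
closedNbhdInClass {m} G c v j =
  length (filter (λ u → ((u ≟ v) ⊎-dec adj? G v u) ×-dec (c u ≟ j)) (vertices m))

-- every vertex v has a color class C with |N[v] ∩ C| ≥ |C| / 2  (i.e. 2|N[v] ∩ C| ≥ |C|)
MajorityDominating : ∀ {m k} → Graph m → Coloring m k → Set
MajorityDominating {m} {k} G c =
  ∀ (v : Fin m) → ∃ λ (j : Fin k) → classSize c j ≤ 2 * closedNbhdInClass G c v j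

HasMDColoring : ∀ {m} → Graph m → ℕ → Set
HasMDColoring {m} G k =
  ∃ λ (c : Coloring m k) → Proper G c × Surjective c × MajorityDominating G c

IsChiMd : ∀ {m} → Graph m → ℕ → Set
IsChiMd G k = HasMDColoring G k × (∀ j → HasMDColoring G j → k ≤ j)

-- Sort the colour classes of a majority dominator colouring of P_m by size into small (≤ 2),
-- medium (3 or 4) and large (≥ 5) ones. A class meets a closed neighbourhood N[v] of a path in
-- at most two vertices, so every vertex lies in or next to a small class, or has its two
-- neighbours in one medium class. Weighting vertices in small, medium and large classes by
-- 6, 3 and 0, and giving each large class a bonus of 12, every class carries at most 12 in
-- total, so (sum of weights) + 12·(number of large classes) ≤ 12k. A left-to-right potential
-- argument bounds the sum of weights below by 2m, by 3m - 3 if no two adjacent vertices are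
-- in large classes, and by 3m + 6 if no vertex is; together with the bonuses this gives
-- 12k ≥ 2m + 23 once m ≥ 17. Conversely, the colouring of P_n that repeats 0, p, 1, 0, p, 1
-- with a fresh colour p in each period of six is a majority dominator colouring with k colours,
-- where 12k ≤ 2n + 34. For n ≥ 11 these give 12 χ_md(P_n) ≤ 2n + 34 < 2(n + 6) + 23
-- ≤ 12 χ_md(P_{n+6}).

module Submission where

open import Data.Bool using (true; false; if_then_else_)
open import Data.Empty using (⊥; ⊥-elim)
open import Data.Fin using (Fin; zero; suc; toℕ; fromℕ<; inject₁)
open import Data.Fin.Properties using (_≟_; any?; toℕ-injective; toℕ-inject₁; toℕ-fromℕ<; toℕ<n)
open import Data.List using (List; []; _∷_; length; filter; tabulate; allFin)
open import Data.List.Membership.Propositional using (_∈_)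
open import Data.List.Membership.Propositional.Properties using (∈-filter⁻; ∈-filter⁺; ∈-allFin; ∈-length)
open import Data.List.Relation.Unary.Any using (here; there)
import Data.List.Relation.Unary.All as All
import Data.List.Relation.Unary.AllPairs as AllPairs
open import Data.List.Relation.Unary.Unique.Propositional using (Unique)
import Data.List.Relation.Unary.Unique.Propositional.Properties as Unique
open import Data.Maybe using (Maybe; nothing; just)
import Data.Maybe.Properties as Maybe
open import Data.Nat using (ℕ; zero; suc; _+_; _*_; _∸_; _/_; _≤_; _<_; _≤?_; _<?_; z≤n; s≤s)
open import Data.Nat.DivMod using (/-monoˡ-≤; m*n/n≡m; m/n*n≤m)
open import Data.Nat.Properties hiding (_≟_)
open import Algebra.Properties.Semiring.Sum +-*-semiring
  using (sum-syntax; sum-cong-≗; sum-replicate-zero; ∑-comm; ∑-distrib-+; *-distribʳ-sum)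
open import Data.Nat.Tactic.RingSolver using (solve; solve-∀)
open import Data.Product using (_×_; _,_; proj₂; ∃)
open import Data.Sum using (_⊎_; inj₁; inj₂)
open import Function using (_∘_)
open import Function.Definitions using (Injective)
open import Relation.Binary using (DecidableEquality)
open import Relation.Binary.PropositionalEquality using (_≡_; _≢_; refl; sym; trans; cong; cong₂; subst; module ≡-Reasoning)
open import Relation.Nullary using (¬_; Dec; does; yes; no)
open import Relation.Nullary.Decidable using (_⊎-dec_; _×-dec_; _→-dec_; ¬?; from-yes; map′)
open import Relation.Unary using (Pred; Decidable)

open import Defs

indicator : ∀ {A : Set} {p} {P : Pred A p} → Decidable P → A → ℕ
indicator P? x = if does (P? x) then 1 else 0

∑-mono-≤ : ∀ {n} {f g : Fin n → ℕ} → (∀ i → f i ≤ g i) → ∑[ i < n ] f i ≤ ∑[ i < n ] g i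
∑-mono-≤ {zero}  f≤g = z≤n
∑-mono-≤ {suc n} f≤g = +-mono-≤ (f≤g zero) (∑-mono-≤ (f≤g ∘ suc))

∑-const : ∀ n c → ∑[ i < n ] c ≡ n * c
∑-const zero    c = refl
∑-const (suc n) c = cong (c +_) (∑-const n c)

term≤∑ : ∀ {n} (f : Fin n → ℕ) i → f i ≤ ∑[ j < n ] f j
term≤∑ f zero    = m≤m+n _ _
term≤∑ f (suc i) = ≤-trans (term≤∑ (f ∘ suc) i) (m≤n+m _ (f zero))

two-terms≤∑ : ∀ {n} (f : Fin n → ℕ) {i j} → i ≢ j → f i + f j ≤ ∑[ k < n ] f k
two-terms≤∑ f {zero}  {zero}  i≢j = ⊥-elim (i≢j refl)
two-terms≤∑ f {zero}  {suc j} _   = +-monoʳ-≤ (f zero) (term≤∑ (f ∘ suc) j)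
two-terms≤∑ f {suc i} {zero}  _   =
  subst (_≤ ∑[ k < _ ] f k) (+-comm (f zero) (f (suc i))) (+-monoʳ-≤ (f zero) (term≤∑ (f ∘ suc) i))
two-terms≤∑ f {suc i} {suc j} i≢j = ≤-trans (two-terms≤∑ (f ∘ suc) (i≢j ∘ cong suc)) (m≤n+m _ (f zero))

length-filter-tabulate : ∀ {A : Set} {p} {P : Pred A p} (P? : Decidable P) {m} (f : Fin m → A) →
  length (filter P? (tabulate f)) ≡ ∑[ i < m ] indicator P? (f i)
length-filter-tabulate P? {zero}  f = refl
length-filter-tabulate P? {suc m} f with does (P? (f zero))
... | true  = cong suc (length-filter-tabulate P? (f ∘ suc))
... | false = length-filter-tabulate P? (f ∘ suc)

∑-indicator-≟ : ∀ {k} (a : Fin k) (g : Fin k → ℕ) → ∑[ j < k ] (indicator (a ≟_) j * g j) ≡ g a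
∑-indicator-≟ {suc k} zero    g = begin
  g zero + 0 + ∑[ j < k ] 0 ≡⟨ cong (g zero + 0 +_) (sum-replicate-zero k) ⟩
  g zero + 0 + 0           ≡⟨ +-identityʳ _ ⟩
  g zero + 0               ≡⟨ +-identityʳ _ ⟩
  g zero                   ∎
  where open ≡-Reasoning
∑-indicator-≟ {suc k} (suc a) g = ∑-indicator-≟ a (g ∘ suc)

∑-by-class : ∀ {m k} (c : Coloring m k) (g : Fin k → ℕ) →
  ∑[ v < m ] g (c v) ≡ ∑[ j < k ] (classSize c j * g j)
∑-by-class {m} {k} c g = begin
  ∑[ v < m ] g (c v)                                    ≡⟨ sum-cong-≗ (λ v → sym (∑-indicator-≟ (c v) g)) ⟩
  ∑[ v < m ] ∑[ j < k ] (indicator (c v ≟_) j * g j)    ≡⟨ ∑-comm (λ v j → indicator (c v ≟_) j * g j) ⟩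
  ∑[ j < k ] ∑[ v < m ] (indicator (c v ≟_) j * g j)
    ≡⟨ sum-cong-≗ (λ j → sym (*-distribʳ-sum (g j) (λ v → indicator (c v ≟_) j))) ⟩
  ∑[ j < k ] (∑[ v < m ] indicator (c v ≟_) j * g j)
    ≡⟨ sum-cong-≗ (λ j → cong (_* g j) (sym (length-filter-tabulate (λ v → c v ≟ j) (λ v → v)))) ⟩
  ∑[ j < k ] (classSize c j * g j)                      ∎
  where open ≡-Reasoning

-- Kinds of colour classes

data Kind : Set where
  small medium large : Kind

_≟ᴷ_ : DecidableEquality Kind
small  ≟ᴷ small  = yes refl
medium ≟ᴷ medium = yes refl
large  ≟ᴷ large  = yes refl
small  ≟ᴷ medium = no λ ()
small  ≟ᴷ large  = no λ ()
medium ≟ᴷ small  = no λ ()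
medium ≟ᴷ large  = no λ ()
large  ≟ᴷ small  = no λ ()
large  ≟ᴷ medium = no λ ()

_≟ᴹ_ : DecidableEquality (Maybe Kind)
_≟ᴹ_ = Maybe.≡-dec _≟ᴷ_

every-kind? : {P : Kind → Set} → (∀ x → Dec (P x)) → Dec (∀ x → P x)
every-kind? P? = map′ (λ (s , m , l) → λ { small → s ; medium → m ; large → l })
                      (λ ∀P → ∀P small , ∀P medium , ∀P large)
                      (P? small ×-dec P? medium ×-dec P? large)

every-context? : {P : Maybe Kind → Set} → (∀ l → Dec (P l)) → Dec (∀ l → P l)
every-context? P? = map′ (λ (n , j) → λ { nothing → n ; (just x) → j x })
                         (λ ∀P → ∀P nothing , λ x → ∀P (just x))
                         (P? nothing ×-dec every-kind? (P? ∘ just))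

kindOf : ℕ → Kind
kindOf 0 = small
kindOf 1 = small
kindOf 2 = small
kindOf 3 = medium
kindOf 4 = medium
kindOf _ = large

kindOf-≤4 : ∀ {s} → s ≤ 4 → kindOf s ≡ small ⊎ (kindOf s ≡ medium × 3 ≤ s)
kindOf-≤4 {0} _ = inj₁ refl
kindOf-≤4 {1} _ = inj₁ refl
kindOf-≤4 {2} _ = inj₁ refl
kindOf-≤4 {3} _ = inj₂ (refl , ≤-refl)
kindOf-≤4 {4} _ = inj₂ (refl , s≤s (s≤s (s≤s z≤n)))
kindOf-≤4 {suc (suc (suc (suc (suc _))))} (s≤s (s≤s (s≤s (s≤s ()))))

weight : Kind → ℕ
weight small  = 6
weight medium = 3
weight large  = 0

bonus : Kind → ℕ
bonus large = 12
bonus _     = 0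

class-charge≤12 : ∀ s → s * weight (kindOf s) + bonus (kindOf s) ≤ 12
class-charge≤12 0 = z≤n
class-charge≤12 1 = from-yes (6 ≤? 12)
class-charge≤12 2 = ≤-refl
class-charge≤12 3 = from-yes (9 ≤? 12)
class-charge≤12 4 = ≤-refl
class-charge≤12 (suc (suc (suc (suc (suc s))))) = ≤-reflexive (cong (_+ 12) (*-zeroʳ (5 + s)))

-- l and r are the kinds of the neighbours of a vertex of kind x, nothing beyond an end of the path.
Served : Maybe Kind → Kind → Maybe Kind → Set
Served l x r = x ≡ small ⊎ l ≡ just small ⊎ r ≡ just small ⊎ (l ≡ just medium × r ≡ just medium)

served? : ∀ l x r → Dec (Served l x r)
served? l x r = (x ≟ᴷ small) ⊎-dec (l ≟ᴹ just small) ⊎-dec (r ≟ᴹ just small)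
                ⊎-dec ((l ≟ᴹ just medium) ×-dec (r ≟ᴹ just medium))

ServedSparse : Maybe Kind → Kind → Maybe Kind → Set
ServedSparse l x r = Served l x r × ¬ (l ≡ just large × x ≡ large)

served-sparse? : ∀ l x r → Dec (ServedSparse l x r)
served-sparse? l x r = served? l x r ×-dec ¬? ((l ≟ᴹ just large) ×-dec (x ≟ᴷ large))

ServedWithoutLarge : Maybe Kind → Kind → Maybe Kind → Set
ServedWithoutLarge l x r = Served l x r × x ≢ large

served-without-large? : ∀ l x r → Dec (ServedWithoutLarge l x r)
served-without-large? l x r = served? l x r ×-dec ¬? (x ≟ᴷ large)

module _ {A : Set} where

  -- The neighbours of position i of f, where l is the left neighbour of position 0.
  before : ∀ {m} → Maybe A → (Fin m → A) → Fin m → Maybe A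
  before l f zero    = l
  before l f (suc i) = before (just (f zero)) (f ∘ suc) i

  after : ∀ {m} → (Fin m → A) → Fin m → Maybe A
  after {suc zero}    f zero    = nothing
  after {suc (suc m)} f zero    = just (f (suc zero))
  after {suc (suc m)} f (suc i) = after (f ∘ suc) i

  AllWindows : ∀ {m} → (Maybe A → A → Maybe A → Set) → Maybe A → (Fin m → A) → Set
  AllWindows P l f = ∀ i → P (before l f i) (f i) (after f i)

telescope : ∀ {a b w s p p'} → a + p' ≤ w + p → b ≤ s + p' → a + b ≤ (w + s) + p
telescope {a} {b} {w} {s} {p} {p'} head tail = +-cancelʳ-≤ p' (a + b) (w + s + p) (begin
  a + b + p'         ≡⟨ solve (a ∷ b ∷ p' ∷ []) ⟩
  (a + p') + b       ≤⟨ +-mono-≤ head tail ⟩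
  (w + p) + (s + p') ≡⟨ solve (w ∷ p ∷ s ∷ p' ∷ []) ⟩
  w + s + p + p'     ∎)
  where open ≤-Reasoning

module Potential (P : Maybe Kind → Kind → Maybe Kind → Set) (rate end : ℕ) (π : Maybe Kind → Kind → ℕ)
  (step-bound : ∀ l x y → P l x (just y) → rate + π (just x) y ≤ weight x + π l x)
  (end-bound  : ∀ l x → P l x nothing → rate + end ≤ weight x + π l x) where

  potential-bound : ∀ {m} l (f : Fin (suc m) → Kind) → AllWindows P l f →
    suc m * rate + end ≤ ∑[ i < suc m ] weight (f i) + π l (f zero)
  potential-bound {zero} l f windows = begin
    1 * rate + end                     ≡⟨ cong (_+ end) (+-identityʳ rate) ⟩
    rate + end                         ≤⟨ end-bound l (f zero) (windows zero) ⟩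
    weight (f zero) + π l (f zero)     ≡⟨ cong (_+ π l (f zero)) (sym (+-identityʳ _)) ⟩
    weight (f zero) + 0 + π l (f zero) ∎
    where open ≤-Reasoning
  potential-bound {suc m} l f windows = begin
    rate + suc m * rate + end   ≡⟨ +-assoc rate _ end ⟩
    rate + (suc m * rate + end) ≤⟨ telescope {a = rate} {w = weight (f zero)}
                                     (step-bound l (f zero) (f (suc zero)) (windows zero))
                                     (potential-bound (just (f zero)) (f ∘ suc) (windows ∘ suc)) ⟩
    ∑[ i < suc (suc m) ] weight (f i) + π l (f zero) ∎
    where open ≤-Reasoning

served-potential : Maybe Kind → Kind → ℕ
served-potential _            small  = 1
served-potential (just small) medium = 2
served-potential _            medium = 0
served-potential (just small) large  = 5
served-potential _            large  = 3

served-step : ∀ l x y → Served l x (just y) → 2 + served-potential (just x) y ≤ weight x + served-potential l x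
served-step = from-yes (every-context? λ l → every-kind? λ x → every-kind? λ y →
  served? l x (just y) →-dec (2 + served-potential (just x) y ≤? weight x + served-potential l x))

served-end : ∀ l x → Served l x nothing → 2 + 3 ≤ weight x + served-potential l x
served-end = from-yes (every-context? λ l → every-kind? λ x →
  served? l x nothing →-dec (2 + 3 ≤? weight x + served-potential l x))

served-bound : ∀ {m} (f : Fin m → Kind) → AllWindows Served nothing f → m * 2 ≤ ∑[ i < m ] weight (f i)
served-bound {zero}  f windows = z≤n
served-bound {suc m} f windows = +-cancelʳ-≤ 3 _ _ (≤-trans (potential-bound nothing f windows)
  (+-monoʳ-≤ _ (from-yes (every-kind? λ x → served-potential nothing x ≤? 3) (f zero))))
  where open Potential Served 2 3 served-potential served-step served-end

-- The value at (just large , large) is arbitrary: ServedSparse excludes that window.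
sparse-potential : Maybe Kind → Kind → ℕ
sparse-potential (just large) large  = 0
sparse-potential _            large  = 3
sparse-potential (just small) medium = 3
sparse-potential _            _      = 0

sparse-step : ∀ l x y → ServedSparse l x (just y) → 3 + sparse-potential (just x) y ≤ weight x + sparse-potential l x
sparse-step = from-yes (every-context? λ l → every-kind? λ x → every-kind? λ y →
  served-sparse? l x (just y) →-dec (3 + sparse-potential (just x) y ≤? weight x + sparse-potential l x))

sparse-end : ∀ l x → ServedSparse l x nothing → 3 + 0 ≤ weight x + sparse-potential l x
sparse-end = from-yes (every-context? λ l → every-kind? λ x →
  served-sparse? l x nothing →-dec (3 + 0 ≤? weight x + sparse-potential l x))

sparse-bound : ∀ {m} (f : Fin m → Kind) → AllWindows ServedSparse nothing f → m * 3 ≤ ∑[ i < m ] weight (f i) + 3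
sparse-bound {zero}  f windows = z≤n
sparse-bound {suc m} f windows = begin
  suc m * 3                                                       ≡⟨ sym (+-identityʳ _) ⟩
  suc m * 3 + 0                                                   ≤⟨ potential-bound nothing f windows ⟩
  ∑[ i < suc m ] weight (f i) + sparse-potential nothing (f zero)
    ≤⟨ +-monoʳ-≤ _ (from-yes (every-kind? λ x → sparse-potential nothing x ≤? 3) (f zero)) ⟩
  ∑[ i < suc m ] weight (f i) + 3                                 ∎
  where
  open ≤-Reasoning
  open Potential ServedSparse 3 0 sparse-potential sparse-step sparse-end

first-pair-weight : ∀ x y → ServedWithoutLarge nothing x (just y) → y ≢ large → 9 ≤ weight x + weight y
first-pair-weight = from-yes (every-kind? λ x → every-kind? λ y →
  served-without-large? nothing x (just y) →-dec ¬? (y ≟ᴷ large) →-dec (9 ≤? weight x + weight y))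

last-pair-weight : ∀ x y → x ≢ large → ServedWithoutLarge (just x) y nothing → 9 ≤ weight x + weight y
last-pair-weight = from-yes (every-kind? λ x → every-kind? λ y →
  ¬? (x ≟ᴷ large) →-dec served-without-large? (just x) y nothing →-dec (9 ≤? weight x + weight y))

without-large-tail-bound : ∀ {m} l (f : Fin (2 + m) → Kind) → AllWindows ServedWithoutLarge l f →
  (2 + m) * 3 + 3 ≤ ∑[ i < 2 + m ] weight (f i)
without-large-tail-bound {zero} l f windows =
  subst (9 ≤_) (cong (weight (f zero) +_) (sym (+-identityʳ _)))
    (last-pair-weight (f zero) (f (suc zero)) (proj₂ (windows zero)) (windows (suc zero)))
without-large-tail-bound {suc m} l f windows =
  +-mono-≤ (weight≥3 (proj₂ (windows zero))) (without-large-tail-bound (just (f zero)) (f ∘ suc) (windows ∘ suc))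
  where
  weight≥3 : ∀ {x} → x ≢ large → 3 ≤ weight x
  weight≥3 {small}  _       = s≤s (s≤s (s≤s z≤n))
  weight≥3 {medium} _       = ≤-refl
  weight≥3 {large}  x≢large = ⊥-elim (x≢large refl)

without-large-bound : ∀ {m} (f : Fin m → Kind) → 4 ≤ m → AllWindows ServedWithoutLarge nothing f →
  m * 3 + 6 ≤ ∑[ i < m ] weight (f i)
without-large-bound {suc (suc (suc (suc m)))} f (s≤s (s≤s (s≤s (s≤s _)))) windows = begin
  (4 + m) * 3 + 6       ≡⟨ solve (m ∷ []) ⟩
  9 + ((2 + m) * 3 + 3) ≤⟨ +-mono-≤ (first-pair-weight (f zero) (f (suc zero)) (windows zero) (proj₂ (windows (suc zero))))
                                    (without-large-tail-bound (just (f (suc zero))) (λ i → f (suc (suc i)))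
                                                              (λ i → windows (suc (suc i)))) ⟩
  weight (f zero) + weight (f (suc zero)) + ∑[ i < 2 + m ] weight (f (suc (suc i)))
                        ≡⟨ +-assoc (weight (f zero)) _ _ ⟩
  ∑[ i < 4 + m ] weight (f i) ∎
  where open ≤-Reasoning

module _ {m : ℕ} where

  infix 4 _⋖_
  _⋖_ : Fin m → Fin m → Set
  u ⋖ v = suc (toℕ u) ≡ toℕ v

  ⋖-unique-left : ∀ {u u' v} → u ⋖ v → u' ⋖ v → u ≡ u'
  ⋖-unique-left u⋖v u'⋖v = toℕ-injective (suc-injective (trans u⋖v (sym u'⋖v)))

  ⋖-unique-right : ∀ {v u u'} → v ⋖ u → v ⋖ u' → u ≡ u'
  ⋖-unique-right v⋖u v⋖u' = toℕ-injective (trans (sym v⋖u) v⋖u')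

  ⋖-asym : ∀ {u v} → u ⋖ v → ¬ v ⋖ u
  ⋖-asym {u} u⋖v v⋖u = m≢1+n+m (toℕ u) (sym (trans (cong suc u⋖v) v⋖u))

  opposite-neighbours : ∀ {v u₁ u₂} → Adj (path m) v u₁ → Adj (path m) v u₂ → u₁ ≢ u₂ →
    (u₁ ⋖ v × v ⋖ u₂) ⊎ (u₂ ⋖ v × v ⋖ u₁)
  opposite-neighbours (inj₁ v⋖u₁) (inj₁ v⋖u₂) u₁≢u₂ = ⊥-elim (u₁≢u₂ (⋖-unique-right v⋖u₁ v⋖u₂))
  opposite-neighbours (inj₂ u₁⋖v) (inj₂ u₂⋖v) u₁≢u₂ = ⊥-elim (u₁≢u₂ (⋖-unique-left u₁⋖v u₂⋖v))
  opposite-neighbours (inj₁ v⋖u₁) (inj₂ u₂⋖v) _     = inj₂ (u₂⋖v , v⋖u₁)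
  opposite-neighbours (inj₂ u₁⋖v) (inj₁ v⋖u₂) _     = inj₁ (u₁⋖v , v⋖u₂)

  no-three-neighbours : ∀ {v u₁ u₂ u₃} → Adj (path m) v u₁ → Adj (path m) v u₂ → Adj (path m) v u₃ →
    u₁ ≢ u₂ → u₁ ≢ u₃ → u₂ ≢ u₃ → ⊥
  no-three-neighbours a₁ a₂ a₃ u₁≢u₂ u₁≢u₃ u₂≢u₃
    with opposite-neighbours a₁ a₂ u₁≢u₂ | opposite-neighbours a₁ a₃ u₁≢u₃
  ... | inj₁ (_ , v⋖u₂) | inj₁ (_ , v⋖u₃) = u₂≢u₃ (⋖-unique-right v⋖u₂ v⋖u₃)
  ... | inj₂ (u₂⋖v , _) | inj₂ (u₃⋖v , _) = u₂≢u₃ (⋖-unique-left u₂⋖v u₃⋖v)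
  ... | inj₁ (u₁⋖v , _) | inj₂ (_ , v⋖u₁) = ⋖-asym u₁⋖v v⋖u₁
  ... | inj₂ (_ , v⋖u₁) | inj₁ (u₁⋖v , _) = ⋖-asym u₁⋖v v⋖u₁

before-⋖ : ∀ {A : Set} {m} l (f : Fin m → A) {u v} → u ⋖ v → before l f v ≡ just (f u)
before-⋖ l f {zero}  {suc zero} refl = refl
before-⋖ l f {suc u} {suc v}    u⋖v  = before-⋖ (just (f zero)) (f ∘ suc) (suc-injective u⋖v)

after-⋖ : ∀ {A : Set} {m} (f : Fin m → A) {v u} → v ⋖ u → after f v ≡ just (f u)
after-⋖ {m = suc (suc m)} f {zero}  {suc zero} refl = refl
after-⋖ {m = suc (suc m)} f {suc v} {suc u}    v⋖u  = after-⋖ (f ∘ suc) (suc-injective v⋖u)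

before-just : ∀ {A : Set} {m} (f : Fin m → A) v {a} → before nothing f v ≡ just a → ∃ λ u → u ⋖ v × f u ≡ a
before-just f (suc i) before≡a =
  inject₁ i , inject₁⋖suc , Maybe.just-injective (trans (sym (before-⋖ nothing f inject₁⋖suc)) before≡a)
  where
  inject₁⋖suc : inject₁ i ⋖ suc i
  inject₁⋖suc = cong suc (toℕ-inject₁ i)

-- The lower bound

sparse-case-arith : ∀ {m w b} → 14 ≤ m → m * 3 ≤ w + 3 → 12 ≤ b → m * 2 + 23 ≤ w + b
sparse-case-arith {m} {w} {b} 14≤m m*3≤w+3 12≤b = +-cancelʳ-≤ 3 _ _ (begin
  m * 2 + 23 + 3  ≡⟨ solve (m ∷ []) ⟩
  m * 2 + 14 + 12 ≤⟨ +-mono-≤ (+-monoʳ-≤ (m * 2) 14≤m) 12≤b ⟩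
  m * 2 + m + b   ≡⟨ solve (m ∷ b ∷ []) ⟩
  m * 3 + b       ≤⟨ +-monoˡ-≤ b m*3≤w+3 ⟩
  w + 3 + b       ≡⟨ solve (w ∷ b ∷ []) ⟩
  w + b + 3       ∎)
  where open ≤-Reasoning

without-large-case-arith : ∀ {m w b} → 17 ≤ m → m * 3 + 6 ≤ w → m * 2 + 23 ≤ w + b
without-large-case-arith {m} {w} {b} 17≤m m*3+6≤w = begin
  m * 2 + 23     ≡⟨ solve (m ∷ []) ⟩
  m * 2 + 17 + 6 ≤⟨ +-monoˡ-≤ 6 (+-monoʳ-≤ (m * 2) 17≤m) ⟩
  m * 2 + m + 6  ≡⟨ solve (m ∷ []) ⟩
  m * 3 + 6      ≤⟨ m*3+6≤w ⟩
  w              ≤⟨ m≤m+n w b ⟩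
  w + b          ∎
  where open ≤-Reasoning

module Colouring {m k} (c : Coloring m k) (proper : Proper (path m) c) where

  size : Fin k → ℕ
  size = classSize c

  classKind : Fin k → Kind
  classKind j = kindOf (size j)

  vertexKind : Fin m → Kind
  vertexKind v = classKind (c v)

  Near : Fin m → Fin k → Fin m → Set
  Near v j u = (u ≡ v ⊎ Adj (path m) v u) × c u ≡ j

  near? : ∀ v j → Decidable (Near v j)
  near? v j u = ((u ≟ v) ⊎-dec adj? (path m) v u) ×-dec (c u ≟ j)

  nearby : Fin m → Fin k → List (Fin m)
  nearby v j = filter (near? v j) (allFin m)

  nearby-near : ∀ {v j u} → u ∈ nearby v j → Near v j u
  nearby-near {v} {j} = proj₂ ∘ ∈-filter⁻ (near? v j) {xs = allFin m}

  nearby-unique : ∀ v j → Unique (nearby v j)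
  nearby-unique v j = Unique.filter⁺ (near? v j) (Unique.allFin⁺ m)

  same-class-adjacent : ∀ {v j u₁ u₂} → Near v j u₁ → Near v j u₂ → u₁ ≢ u₂ → Adj (path m) v u₁
  same-class-adjacent (inj₂ v~u₁ , _)   _                  _   = v~u₁
  same-class-adjacent (inj₁ refl , _)   (inj₁ refl , _)    u≢u = ⊥-elim (u≢u refl)
  same-class-adjacent (inj₁ refl , c≡j) (inj₂ v~u₂ , c₂≡j) _   = ⊥-elim (proper _ _ v~u₂ (trans c≡j (sym c₂≡j)))

  near-list-length≤2 : ∀ {v j} us → (∀ {u} → u ∈ us → Near v j u) → Unique us → length us ≤ 2
  near-list-length≤2 []           _ _ = z≤n
  near-list-length≤2 (_ ∷ [])     _ _ = s≤s z≤n
  near-list-length≤2 (_ ∷ _ ∷ []) _ _ = s≤s (s≤s z≤n)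
  near-list-length≤2 (u₁ ∷ u₂ ∷ u₃ ∷ _) near
    ((u₁≢u₂ All.∷ u₁≢u₃ All.∷ _) AllPairs.∷ (u₂≢u₃ All.∷ _) AllPairs.∷ _) = ⊥-elim
    (no-three-neighbours (same-class-adjacent n₁ n₂ u₁≢u₂) (same-class-adjacent n₂ n₁ (u₁≢u₂ ∘ sym))
                         (same-class-adjacent n₃ n₁ (u₁≢u₃ ∘ sym)) u₁≢u₂ u₁≢u₃ u₂≢u₃)
    where
    n₁ = near (here refl)
    n₂ = near (there (here refl))
    n₃ = near (there (there (here refl)))

  ServedAt : Fin m → Set
  ServedAt v = Served (before nothing vertexKind v) (vertexKind v) (after vertexKind v)

  served-by-near : ∀ {v j u} → Near v j u → classKind j ≡ small → ServedAt v
  served-by-near (inj₁ refl , cv≡j) j-small = inj₁ (trans (cong classKind cv≡j) j-small)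
  served-by-near (inj₂ (inj₂ u⋖v) , cu≡j) j-small =
    inj₂ (inj₁ (trans (before-⋖ nothing vertexKind u⋖v) (cong just (trans (cong classKind cu≡j) j-small))))
  served-by-near (inj₂ (inj₁ v⋖u) , cu≡j) j-small =
    inj₂ (inj₂ (inj₁ (trans (after-⋖ vertexKind v⋖u) (cong just (trans (cong classKind cu≡j) j-small)))))

  served-by-pair : ∀ {v j u₁ u₂} → u₁ ⋖ v → v ⋖ u₂ → c u₁ ≡ j → c u₂ ≡ j → classKind j ≡ medium → ServedAt v
  served-by-pair u₁⋖v v⋖u₂ cu₁≡j cu₂≡j j-medium = inj₂ (inj₂ (inj₂
    ( trans (before-⋖ nothing vertexKind u₁⋖v) (cong just (trans (cong classKind cu₁≡j) j-medium))
    , trans (after-⋖ vertexKind v⋖u₂) (cong just (trans (cong classKind cu₂≡j) j-medium)))))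

  module Majority (onto : Surjective c) (majority : MajorityDominating (path m) c) where

    size-positive : ∀ j → 1 ≤ size j
    size-positive j with onto j
    ... | v , cv≡j = ∈-length (∈-filter⁺ (λ u → c u ≟ j) (∈-allFin v) cv≡j)

    served-at : ∀ v → ServedAt v
    served-at v with majority v
    ... | j , size≤ = from-nearby (nearby v j) nearby-near (nearby-unique v j) size≤
      where
      from-pair : ∀ {u₁ u₂} → Near v j u₁ → Near v j u₂ → u₁ ≢ u₂ → classKind j ≡ medium → ServedAt v
      from-pair n₁ n₂ u₁≢u₂ j-medium
        with opposite-neighbours (same-class-adjacent n₁ n₂ u₁≢u₂) (same-class-adjacent n₂ n₁ (u₁≢u₂ ∘ sym)) u₁≢u₂
      ... | inj₁ (u₁⋖v , v⋖u₂) = served-by-pair u₁⋖v v⋖u₂ (proj₂ n₁) (proj₂ n₂) j-medium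
      ... | inj₂ (u₂⋖v , v⋖u₁) = served-by-pair u₂⋖v v⋖u₁ (proj₂ n₂) (proj₂ n₁) j-medium

      from-nearby : ∀ us → (∀ {u} → u ∈ us → Near v j u) → Unique us → size j ≤ 2 * length us → ServedAt v
      from-nearby us near unique size≤
        with kindOf-≤4 (≤-trans size≤ (*-monoʳ-≤ 2 (near-list-length≤2 us near unique)))
      from-nearby []       _    _ size≤ | _                 = ⊥-elim (<⇒≱ (size-positive j) size≤)
      from-nearby (u ∷ _)  near _ _     | inj₁ j-small      = served-by-near (near (here refl)) j-small
      from-nearby (u ∷ []) _    _ size≤ | inj₂ (_ , 3≤size) = ⊥-elim (<⇒≱ 3≤size size≤)
      from-nearby (u₁ ∷ u₂ ∷ _) near ((u₁≢u₂ All.∷ _) AllPairs.∷ _) _ | inj₂ (j-medium , _) =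
        from-pair (near (here refl)) (near (there (here refl))) u₁≢u₂ j-medium

    weights : ℕ
    weights = ∑[ v < m ] weight (vertexKind v)

    bonuses : ℕ
    bonuses = ∑[ j < k ] bonus (classKind j)

    weights+bonuses≤ : weights + bonuses ≤ k * 12
    weights+bonuses≤ = begin
      ∑[ v < m ] weight (classKind (c v)) + bonuses
        ≡⟨ cong (_+ bonuses) (∑-by-class c (weight ∘ classKind)) ⟩
      ∑[ j < k ] (size j * weight (classKind j)) + ∑[ j < k ] bonus (classKind j)
        ≡⟨ sym (∑-distrib-+ (λ j → size j * weight (classKind j)) (bonus ∘ classKind)) ⟩
      ∑[ j < k ] (size j * weight (classKind j) + bonus (classKind j))
        ≤⟨ ∑-mono-≤ (class-charge≤12 ∘ size) ⟩
      ∑[ j < k ] 12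
        ≡⟨ ∑-const k 12 ⟩
      k * 12 ∎
      where open ≤-Reasoning

    large-bound : ∀ {v} → vertexKind v ≡ large → 12 ≤ bonuses
    large-bound {v} v-large = subst (_≤ bonuses) (cong bonus v-large) (term≤∑ (bonus ∘ classKind) (c v))

    large-neighbours-bound : ∀ {u v} → u ⋖ v → vertexKind u ≡ large → vertexKind v ≡ large → 24 ≤ bonuses
    large-neighbours-bound {u} {v} u⋖v u-large v-large =
      subst (_≤ bonuses) (cong₂ _+_ (cong bonus u-large) (cong bonus v-large))
        (two-terms≤∑ (bonus ∘ classKind) (proper u v (inj₁ u⋖v)))

    weights+bonuses≥ : 17 ≤ m → m * 2 + 23 ≤ weights + bonuses
    weights+bonuses≥ 17≤m = by-pair (any? λ v → (before nothing vertexKind v ≟ᴹ just large) ×-dec (vertexKind v ≟ᴷ large))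
      where
      by-large : ¬ (∃ λ v → before nothing vertexKind v ≡ just large × vertexKind v ≡ large) →
        Dec (∃ λ v → vertexKind v ≡ large) → m * 2 + 23 ≤ weights + bonuses
      by-large no-large-pair (yes (v , v-large)) = sparse-case-arith (≤-trans (from-yes (14 ≤? 17)) 17≤m)
        (sparse-bound vertexKind (λ v → served-at v , λ large-pair → no-large-pair (v , large-pair)))
        (large-bound v-large)
      by-large _ (no no-large) = without-large-case-arith 17≤m
        (without-large-bound vertexKind (≤-trans (from-yes (4 ≤? 17)) 17≤m)
          (λ v → served-at v , λ v-large → no-large (v , v-large)))

      by-pair : Dec (∃ λ v → before nothing vertexKind v ≡ just large × vertexKind v ≡ large) →
        m * 2 + 23 ≤ weights + bonuses
      by-pair (yes (v , left-large , v-large)) with before-just vertexKind v left-large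
      ... | u , u⋖v , u-large = +-mono-≤ (served-bound vertexKind served-at)
                                  (≤-trans (from-yes (23 ≤? 24)) (large-neighbours-bound u⋖v u-large v-large))
      by-pair (no no-large-pair) = by-large no-large-pair (any? λ v → vertexKind v ≟ᴷ large)

    lower-bound : 17 ≤ m → m * 2 + 23 ≤ k * 12
    lower-bound 17≤m = ≤-trans (weights+bonuses≥ 17≤m) weights+bonuses≤

-- The upper bound

next-pair : ℕ → ℕ
next-pair 0             = 0
next-pair 1             = 1
next-pair (suc (suc q)) = suc (suc (suc q))

next-pair-injective : ∀ {x y} → next-pair x ≡ next-pair y → x ≡ y
next-pair-injective {0}           {0}           _  = refl
next-pair-injective {1}           {1}           _  = refl
next-pair-injective {suc (suc x)} {suc (suc y)} eq = cong (2 +_) (suc-injective (suc-injective (suc-injective eq)))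
next-pair-injective {0}           {1}           ()
next-pair-injective {0}           {suc (suc _)} ()
next-pair-injective {1}           {0}           ()
next-pair-injective {1}           {suc (suc _)} ()
next-pair-injective {suc (suc _)} {0}           ()
next-pair-injective {suc (suc _)} {1}           ()

-- Positions 3t and 3t + 2 get colours 0 and 1; positions 6q + 1 and 6q + 4 form the class 2 + q.
colour : ℕ → ℕ
colour 0 = 0
colour 1 = 2
colour 2 = 1
colour 3 = 0
colour 4 = 2
colour 5 = 1
colour (suc (suc (suc (suc (suc (suc x)))))) = next-pair (colour x)

colour-proper : ∀ x → colour x ≢ colour (suc x)
colour-proper 0 ()
colour-proper 1 ()
colour-proper 2 ()
colour-proper 3 ()
colour-proper 4 ()
colour-proper 5 ()
colour-proper (suc (suc (suc (suc (suc (suc x)))))) eq = colour-proper x (next-pair-injective eq)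

colour-pair : ∀ x q → colour x ≡ 2 + q → x ≡ 1 + q * 6 ⊎ x ≡ 4 + q * 6
colour-pair 1 0 _ = inj₁ refl
colour-pair 4 0 _ = inj₂ refl
colour-pair (suc (suc (suc (suc (suc (suc x)))))) q eq
  with colour x in colour≡ | q
... | 0           | _     = ⊥-elim (0≢1+n eq)
... | 1           | _     = ⊥-elim (0≢1+n (suc-injective eq))
... | suc (suc p) | 0     = ⊥-elim (0≢1+n (sym (suc-injective (suc-injective eq))))
... | suc (suc p) | suc q
  with colour-pair x q (trans colour≡ (cong (2 +_) (suc-injective (suc-injective (suc-injective eq)))))
...   | inj₁ x≡ = inj₁ (cong (6 +_) x≡)
...   | inj₂ x≡ = inj₂ (cong (6 +_) x≡)

colour-first-of-pair : ∀ q → colour (1 + q * 6) ≡ 2 + q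
colour-first-of-pair 0       = refl
colour-first-of-pair (suc q) = cong next-pair (colour-first-of-pair q)

phase : ℕ → ℕ
phase 0 = 0
phase 1 = 1
phase 2 = 2
phase (suc (suc (suc x))) = phase x

phase-cases : ∀ x → phase x ≡ 0 ⊎ phase x ≡ 1 ⊎ phase x ≡ 2
phase-cases 0 = inj₁ refl
phase-cases 1 = inj₂ (inj₁ refl)
phase-cases 2 = inj₂ (inj₂ refl)
phase-cases (suc (suc (suc x))) = phase-cases x

phase-0-suc : ∀ x → phase x ≡ 0 → phase (suc x) ≡ 1
phase-0-suc 0                   _  = refl
phase-0-suc (suc (suc (suc x))) eq = phase-0-suc x eq

phase-2-pred : ∀ x → phase (suc x) ≡ 2 → phase x ≡ 1
phase-2-pred 1                   _  = refl
phase-2-pred (suc (suc (suc x))) eq = phase-2-pred x eq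

phase-1-paired : ∀ x → phase x ≡ 1 → ∃ λ q → colour x ≡ 2 + q
phase-1-paired 1 _ = 0 , refl
phase-1-paired 4 _ = 0 , refl
phase-1-paired (suc (suc (suc (suc (suc (suc x)))))) eq with phase-1-paired x eq
... | q , colour≡ = suc q , cong next-pair colour≡

-- Vertex i of P_n sits at position i + offset n, so that the first vertex is not at phase 2 and
-- the last one not at phase 0: each of them then has a vertex at phase 1 in its closed neighbourhood.
offset : ℕ → ℕ
offset 0 = 0
offset 1 = 1
offset 2 = 0
offset (suc (suc (suc n))) = offset n

offset≤1 : ∀ n → offset n ≤ 1
offset≤1 0 = z≤n
offset≤1 1 = ≤-refl
offset≤1 2 = z≤n
offset≤1 (suc (suc (suc n))) = offset≤1 n

phase-offset : ∀ n → phase (offset n) ≢ 2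
phase-offset (suc (suc (suc n))) = phase-offset n

phase-past-end : ∀ n → phase (n + offset n) ≢ 1
phase-past-end (suc (suc (suc n))) = phase-past-end n

length≤2-of-two-values : ∀ {A B : Set} (f : A → B) → Injective _≡_ _≡_ f → ∀ {a b} xs → Unique xs →
  (∀ {x} → x ∈ xs → f x ≡ a ⊎ f x ≡ b) → length xs ≤ 2
length≤2-of-two-values f f-inj []           _ _ = z≤n
length≤2-of-two-values f f-inj (_ ∷ [])     _ _ = s≤s z≤n
length≤2-of-two-values f f-inj (_ ∷ _ ∷ []) _ _ = s≤s (s≤s z≤n)
length≤2-of-two-values f f-inj (x₁ ∷ x₂ ∷ x₃ ∷ _)
  ((x₁≢x₂ All.∷ x₁≢x₃ All.∷ _) AllPairs.∷ (x₂≢x₃ All.∷ _) AllPairs.∷ _) values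
  with values (here refl) | values (there (here refl)) | values (there (there (here refl)))
... | inj₁ p | inj₁ q | _      = ⊥-elim (x₁≢x₂ (f-inj (trans p (sym q))))
... | inj₂ p | inj₂ q | _      = ⊥-elim (x₁≢x₂ (f-inj (trans p (sym q))))
... | inj₁ p | _      | inj₁ r = ⊥-elim (x₁≢x₃ (f-inj (trans p (sym r))))
... | inj₂ p | _      | inj₂ r = ⊥-elim (x₁≢x₃ (f-inj (trans p (sym r))))
... | _      | inj₁ q | inj₁ r = ⊥-elim (x₂≢x₃ (f-inj (trans q (sym r))))
... | _      | inj₂ q | inj₂ r = ⊥-elim (x₂≢x₃ (f-inj (trans q (sym r))))

module PeriodicColouring (n : ℕ) (4≤n : 4 ≤ n) where

  δ : ℕ
  δ = offset n

  N : ℕ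
  N = n + δ

  pairs : ℕ
  pairs = (N + 4) / 6

  k : ℕ
  k = 2 + pairs

  pair<pairs : ∀ {q} → 2 + q * 6 ≤ N → q < pairs
  pair<pairs {q} 2+6q≤N = begin
    suc q         ≡⟨ sym (m*n/n≡m (suc q) 6) ⟩
    suc q * 6 / 6 ≤⟨ /-monoˡ-≤ 6 (subst (_≤ N + 4) (+-comm (2 + q * 6) 4) (+-monoˡ-≤ 4 2+6q≤N)) ⟩
    (N + 4) / 6   ∎
    where open ≤-Reasoning

  pair≤ : ∀ {q} → q < pairs → 2 + q * 6 ≤ N
  pair≤ {q} q<pairs = +-cancelʳ-≤ 4 (2 + q * 6) N (begin
    2 + q * 6 + 4 ≡⟨ +-comm (2 + q * 6) 4 ⟩
    suc q * 6     ≤⟨ *-monoˡ-≤ 6 q<pairs ⟩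
    pairs * 6     ≤⟨ m/n*n≤m (N + 4) 6 ⟩
    N + 4         ∎)
    where open ≤-Reasoning

  colour<k : ∀ x → x < N → colour x < k
  colour<k x x<N with colour x in colour≡
  ... | 0           = s≤s z≤n
  ... | 1           = s≤s (s≤s z≤n)
  ... | suc (suc q) = s≤s (s≤s (pair<pairs (≤-trans (first≤ (colour-pair x q colour≡)) x<N)))
    where
    first≤ : x ≡ 1 + q * 6 ⊎ x ≡ 4 + q * 6 → 2 + q * 6 ≤ suc x
    first≤ (inj₁ refl) = ≤-refl
    first≤ (inj₂ refl) = s≤s (+-monoˡ-≤ (q * 6) (from-yes (1 ≤? 4)))

  position : Fin n → ℕ
  position v = toℕ v + δ

  position-injective : ∀ {u v} → position u ≡ position v → u ≡ v
  position-injective eq = toℕ-injective (+-cancelʳ-≡ _ _ _ eq)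

  c : Coloring n k
  c v = fromℕ< (colour<k (position v) (+-monoˡ-< δ (toℕ<n v)))

  toℕ-c : ∀ v → toℕ (c v) ≡ colour (position v)
  toℕ-c v = toℕ-fromℕ< _

  proper : Proper (path n) c
  proper u v (inj₁ u⋖v) cu≡cv = colour-proper (position u)
    (trans (sym (toℕ-c u)) (trans (cong toℕ cu≡cv) (trans (toℕ-c v) (cong (λ i → colour (i + δ)) (sym u⋖v)))))
  proper u v (inj₂ v⋖u) cu≡cv = colour-proper (position v)
    (trans (sym (toℕ-c v)) (trans (cong toℕ (sym cu≡cv)) (trans (toℕ-c u) (cong (λ i → colour (i + δ)) (sym v⋖u)))))

  vertex-at : ∀ x → δ ≤ x → x < N → ∃ λ v → position v ≡ x
  vertex-at x δ≤x x<N = fromℕ< x∸δ<n , trans (cong (_+ δ) (toℕ-fromℕ< x∸δ<n)) (m∸n+n≡m δ≤x)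
    where
    x∸δ<n : x ∸ δ < n
    x∸δ<n = +-cancelʳ-< δ (x ∸ δ) n (subst (_< N) (sym (m∸n+n≡m δ≤x)) x<N)

  onto : Surjective c
  onto j = hit (position-of j) (δ≤position-of j) (position-of<N j) (colour-position-of j)
    where
    position-of : Fin k → ℕ
    position-of zero          = 3
    position-of (suc zero)    = 2
    position-of (suc (suc q)) = 1 + toℕ q * 6

    δ≤position-of : ∀ j → δ ≤ position-of j
    δ≤position-of zero          = ≤-trans (offset≤1 n) (from-yes (1 ≤? 3))
    δ≤position-of (suc zero)    = ≤-trans (offset≤1 n) (from-yes (1 ≤? 2))
    δ≤position-of (suc (suc q)) = ≤-trans (offset≤1 n) (s≤s z≤n)

    position-of<N : ∀ j → position-of j < N
    position-of<N zero          = ≤-trans 4≤n (m≤m+n n δ)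
    position-of<N (suc zero)    = ≤-trans (from-yes (3 ≤? 4)) (≤-trans 4≤n (m≤m+n n δ))
    position-of<N (suc (suc q)) = pair≤ (toℕ<n q)

    colour-position-of : ∀ j → colour (position-of j) ≡ toℕ j
    colour-position-of zero          = refl
    colour-position-of (suc zero)    = refl
    colour-position-of (suc (suc q)) = colour-first-of-pair (toℕ q)

    hit : ∀ x → δ ≤ x → x < N → colour x ≡ toℕ j → ∃ λ v → c v ≡ j
    hit x δ≤x x<N colour≡ with vertex-at x δ≤x x<N
    ... | v , position≡ = v , toℕ-injective (trans (toℕ-c v) (trans (cong colour position≡) colour≡))

  near-phase-1 : ∀ v → ∃ λ u → (u ≡ v ⊎ Adj (path n) v u) × phase (position u) ≡ 1
  near-phase-1 v with phase-cases (position v)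
  ... | inj₂ (inj₁ phase≡1) = v , inj₁ refl , phase≡1
  ... | inj₁ phase≡0 with suc (toℕ v) <? n
  ...   | yes 1+v<n = fromℕ< 1+v<n , inj₂ (inj₁ (sym (toℕ-fromℕ< 1+v<n))) ,
                      subst (λ i → phase (i + δ) ≡ 1) (sym (toℕ-fromℕ< 1+v<n)) (phase-0-suc (position v) phase≡0)
  ...   | no 1+v≮n  = ⊥-elim (phase-past-end n
                        (subst (λ i → phase (i + δ) ≡ 1) (≤-antisym (toℕ<n v) (≮⇒≥ 1+v≮n)) (phase-0-suc (position v) phase≡0)))
  near-phase-1 v | inj₂ (inj₂ phase≡2) with toℕ v in v≡
  ... | zero  = ⊥-elim (phase-offset n phase≡2)
  ... | suc i = fromℕ< i<n , inj₂ (inj₂ (cong suc (toℕ-fromℕ< i<n))) ,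
                subst (λ i → phase (i + δ) ≡ 1) (sym (toℕ-fromℕ< i<n)) (phase-2-pred (i + δ) phase≡2)
    where
    i<n : i < n
    i<n = <-trans (n<1+n i) (subst (_< n) v≡ (toℕ<n v))

  phase-1-class-size≤2 : ∀ u → phase (position u) ≡ 1 → classSize c (c u) ≤ 2
  phase-1-class-size≤2 u phase≡1 with phase-1-paired (position u) phase≡1
  ... | q , colour≡ = length≤2-of-two-values position position-injective _
                        (Unique.filter⁺ (λ w → c w ≟ c u) (Unique.allFin⁺ n)) in-pair
    where
    in-pair : ∀ {w} → w ∈ filter (λ w → c w ≟ c u) (allFin n) → position w ≡ 1 + q * 6 ⊎ position w ≡ 4 + q * 6
    in-pair {w} w∈ = colour-pair (position w) q (trans (sym (toℕ-c w))
      (trans (cong toℕ (proj₂ (∈-filter⁻ (λ w → c w ≟ c u) {xs = allFin n} w∈))) (trans (toℕ-c u) colour≡)))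

  majority : MajorityDominating (path n) c
  majority v with near-phase-1 v
  ... | u , u-near , phase≡1 = c u , ≤-trans (phase-1-class-size≤2 u phase≡1) (*-monoʳ-≤ 2 (∈-length u∈))
    where
    u∈ : u ∈ filter (λ w → ((w ≟ v) ⊎-dec adj? (path n) v w) ×-dec (c w ≟ c u)) (allFin n)
    u∈ = ∈-filter⁺ (λ w → ((w ≟ v) ⊎-dec adj? (path n) v w) ×-dec (c w ≟ c u)) (∈-allFin u) (u-near , refl)

  has-md-colouring : HasMDColoring (path n) k
  has-md-colouring = c , proper , onto , majority

  k-bound : k * 12 ≤ n * 2 + 34
  k-bound = begin
    (2 + pairs) * 12     ≡⟨ expand pairs ⟩
    pairs * 6 * 2 + 24   ≤⟨ +-monoˡ-≤ 24 (*-monoˡ-≤ 2 (m/n*n≤m (N + 4) 6)) ⟩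
    (n + δ + 4) * 2 + 24 ≤⟨ +-monoˡ-≤ 24 (*-monoˡ-≤ 2 (+-monoˡ-≤ 4 (+-monoʳ-≤ n (offset≤1 n)))) ⟩
    (n + 1 + 4) * 2 + 24 ≡⟨ collect n ⟩
    n * 2 + 34           ∎
    where
    open ≤-Reasoning
    expand : ∀ p → (2 + p) * 12 ≡ p * 6 * 2 + 24
    expand = solve-∀
    collect : ∀ n → (n + 1 + 4) * 2 + 24 ≡ n * 2 + 34
    collect = solve-∀

lemma3p6 : (n : ℕ) → 11 ≤ n → (a b : ℕ) →
    IsChiMd (path n) a → IsChiMd (path (n + 6)) b → a + 1 ≤ b
lemma3p6 n 11≤n a b (_ , a-minimal) ((c , proper , onto , majority) , _) =
  subst (_≤ b) (+-comm 1 a) (*-cancelʳ-< 12 a b (begin-strict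
    a * 12           ≤⟨ *-monoˡ-≤ 12 (a-minimal k has-md-colouring) ⟩
    k * 12           ≤⟨ k-bound ⟩
    n * 2 + 34       <⟨ n<1+n _ ⟩
    suc (n * 2 + 34) ≡⟨ regroup n ⟩
    (n + 6) * 2 + 23 ≤⟨ lower-bound (+-monoˡ-≤ 6 11≤n) ⟩
    b * 12           ∎))
  where
  open PeriodicColouring n (≤-trans (from-yes (4 ≤? 11)) 11≤n) using (k; has-md-colouring; k-bound)
  open Colouring c proper using (module Majority)
  open Majority onto majority using (lower-bound)
  open ≤-Reasoning
  regroup : ∀ n → suc (n * 2 + 34) ≡ (n + 6) * 2 + 23
  regroup = solve-∀
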